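{- Let $G_n$ ($n\ge1$) be the linear crossed polyomino chain with $n$ four-order complete graphs. Then the number of spanning trees of $G_n$ is $$\tau(G_n)=2^{2n+2}\cdot 3^{n-1}.$$
   Context: For $n\geq1$, $G_n$ is the simple graph with vertex set $\{1,\ldots,n+1\}\cup\{1',\ldots,(n+1)'\}$ and edge set consisting of the vertical edges $ii'$ for $1\le i\le n+1$ together with, for each $1\le i\le n$, the edges $i(i+1)$, $i'(i+1)'$, $i(i+1)'$, $i'(i+1)$. $\tau(G)$ denotes the number of spanning trees of $G$. -}

module Defs where

open import Data.Nat using (ℕ; zero; suc; _≤_)
open import Data.Bool using (Bool; true; false)
open import Data.Fin using (Fin; inject₁) renaming (suc to fsuc)
open import Data.Fin.Subset using (Subset; _∈_)
open import Data.Product using (Σ; _×_; _,_)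
open import Data.Sum using (_⊎_)
open import Data.Empty using (⊥)
open import Data.List using (List; []; _∷_; _++_; [_]; length; lookup; map; concatMap; allFin)
open import Data.List.Relation.Unary.Unique.Propositional using (Unique)
open import Data.List.Relation.Unary.Linked using (Linked)
import Data.List.Membership.Propositional as LM
open import Relation.Binary.PropositionalEquality using (_≡_)
open import Relation.Nullary using (¬_)
open import Function.Bundles using (_⇔_)

-- A (finite, simple) graph on vertex type A is given by a duplicate-free list
-- of edges, each edge (u , v) standing for the unordered pair {u , v}.
EdgeList : Set → Set
EdgeList A = List (A × A)

-- A spanning subgraph = a subset of the edges (indexed by position in the list).
EdgeSubset : {A : Set} → EdgeList A → Set
EdgeSubset E = Subset (length E)

Adj : {A : Set} (E : EdgeList A) → EdgeSubset E → A → A → Set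
Adj E S u v = Σ (Fin (length E)) λ i → i ∈ S × (lookup E i ≡ (u , v) ⊎ lookup E i ≡ (v , u))

data Walk {A : Set} (E : EdgeList A) (S : EdgeSubset E) : A → A → Set where
  here : ∀ {u} → Walk E S u u
  step : ∀ {u w v} → Adj E S u w → Walk E S w v → Walk E S u v

Connected : {A : Set} (E : EdgeList A) → EdgeSubset E → Set
Connected {A} E S = (u v : A) → Walk E S u v

HasCycle : {A : Set} (E : EdgeList A) → EdgeSubset E → Set
HasCycle {A} E S = Σ A λ x → Σ (List A) λ xs →
  (2 ≤ length xs) × Unique (x ∷ xs) × Linked (Adj E S) (x ∷ xs ++ [ x ])

IsSpanningTree : {A : Set} (E : EdgeList A) → EdgeSubset E → Set
IsSpanningTree E S = Connected E S × ¬ HasCycle E S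

-- "τ(G) = k": the set of spanning trees has exactly k elements, i.e. it is
-- enumerated by a duplicate-free list of length k.
NumSpanningTrees : {A : Set} → EdgeList A → ℕ → Set
NumSpanningTrees E k = Σ (List (EdgeSubset E)) λ L →
  Unique L × ((S : EdgeSubset E) → (S LM.∈ L) ⇔ IsSpanningTree E S) × length L ≡ k

-- The graph G_n: vertex (i , false) is i+1, vertex (i , true) is (i+1)'.
Vtx : ℕ → Set
Vtx n = Fin (suc n) × Bool

G : (n : ℕ) → EdgeList (Vtx n)
G n = map vertical (allFin (suc n)) ++ concatMap rungs (allFin n)
  where
  vertical : Fin (suc n) → Vtx n × Vtx n
  vertical i = ((i , false) , (i , true))
  rungs : Fin n → List (Vtx n × Vtx n)
  rungs i = ((inject₁ i , false) , (fsuc i , false))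
          ∷ ((inject₁ i , true) , (fsuc i , true))
          ∷ ((inject₁ i , false) , (fsuc i , true))
          ∷ ((inject₁ i , true) , (fsuc i , false)) ∷ []

module Submission where

-- G_n is grown column by column on the left.  A spanning subgraph of G_n is
-- encoded by a bit string β : Bits n (one bit for the vertical edge of G_0,
-- five bits for the edges of each added column), and `encode` is a
-- bijection from bit strings to the edge subsets of G n.  Relative to the
-- two vertices a₀, b₀ of the leftmost column a subgraph is in one of three
-- states: a spanning tree, a spanning forest of two trees separating a₀ and
-- b₀, or dead.  Adding a column only touches four terminals (the new column
-- and the previous leftmost one), so a union-find on these four vertices
-- (`runEdges`) computes the new state from the old state and the five new
-- bits; its correctness rests on two facts about adding an edge to a graph
-- (`cycle-split` and `close-cycle`).  Evaluating it on all 32 bit patterns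
-- gives the transfer numbers: tree and twoTrees each lead to tree in 8
-- ways and to twoTrees in 4 ways, and dead stays dead.  With t n and f n the
-- numbers of spanning trees and separating two-tree forests of G_n, this
-- yields t (n+1) = 8 (t n + f n) and t n + f n = 2 · 12ⁿ, so
-- τ(G_(m+1)) = 16 · 12^m = 2^(2m+4) · 3^m.

open import Level using (0ℓ)
open import Function using (_∘_)
open import Function.Bundles using (mk⇔)
open import Data.Empty using (⊥; ⊥-elim)
open import Data.Unit using (⊤; tt)
open import Data.Bool using (Bool; true; false; if_then_else_)
import Data.Bool.Properties as BoolP
open import Data.Nat using (ℕ; zero; suc; _≤_; s≤s; z≤n; _+_; _*_; _∸_; _^_)
open import Data.Nat.Properties using (+-assoc)
open import Data.Nat.Tactic.RingSolver using (solve-∀)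
open import Data.Fin using (Fin; zero; suc; inject₁)
open import Data.Fin.Properties using (suc-injective) renaming (_≟_ to _≟ᶠ_)
open import Data.Fin.Subset using (Subset) renaming (_∈_ to _∈ₛ_)
open import Data.Product using (Σ; _×_; _,_; proj₁; proj₂)
import Data.Product as Product
open import Data.Product.Properties using (≡-dec)
open import Data.Sum using (_⊎_; inj₁; inj₂)
import Data.Sum as Sum
open import Data.List
  using (List; []; _∷_; _++_; [_]; length; map; concatMap; allFin; cartesianProduct; lookup; filter)
open import Data.List.Properties using (length-map; map-++)
open import Data.List.Membership.Propositional using (_∈_; _∉_)
open import Data.List.Membership.Propositional.Properties
  using (∈-filter⁺; ∈-filter⁻; ∈-++⁺ˡ; ∈-++⁺ʳ; ∈-++⁻; ∈-∃++; ∈-map⁺; ∈-map⁻; ∈-concatMap⁺; ∈-concatMap⁻;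
         ∈-allFin; ∈-lookup; ∈-cartesianProduct⁺)
import Data.List.Membership.DecPropositional as DecMembership
open import Data.List.Relation.Unary.Any using (here; there; satisfied)
import Data.List.Relation.Unary.Any as Any
open import Data.List.Relation.Unary.Any.Properties using (lookup-index)
open import Data.List.Relation.Unary.All using (All)
import Data.List.Relation.Unary.All as All
open import Data.List.Relation.Unary.All.Properties using (All¬⇒¬Any; ¬Any⇒All¬)
import Data.List.Relation.Unary.All.Properties as AllP
open import Data.List.Relation.Unary.AllPairs using (AllPairs; allPairs?; _∷_)
import Data.List.Relation.Unary.AllPairs as AllPairs
import Data.List.Relation.Unary.AllPairs.Properties as AllPairsP
open import Data.List.Relation.Unary.Unique.Propositional using (Unique)
import Data.List.Relation.Unary.Unique.Propositional.Properties as UniqueP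
open import Data.List.Relation.Unary.Linked using (Linked; [-]; _∷_)
import Data.List.Relation.Unary.Linked as Linked
import Data.List.Relation.Unary.Linked.Properties as LinkedP
open import Data.List.Relation.Binary.Disjoint.Propositional using (Disjoint)
open import Data.Vec using (tabulate)
import Data.Vec as Vec
open import Data.Vec.Properties using (lookup∘tabulate; tabulate∘lookup; tabulate-cong; []=⇒lookup; lookup⇒[]=)
open import Relation.Binary.Core using (Rel; _⇒_)
open import Relation.Binary.Definitions using (Symmetric; DecidableEquality)
open import Relation.Binary.Construct.Union using (_∪_) renaming (symmetric to ∪-symmetric)
open import Relation.Binary.Construct.Closure.ReflexiveTransitive using (Star; ε; _◅_; _◅◅_)
import Relation.Binary.Construct.Closure.ReflexiveTransitive as Star
open import Relation.Binary.PropositionalEquality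
  using (_≡_; refl; sym; trans; cong; cong₂; subst; module ≡-Reasoning)
open import Relation.Nullary using (¬_; Dec; yes; no; does; ¬?)
open import Relation.Nullary.Decidable using (_×-dec_; _⊎-dec_; toWitness)
open import Defs using (Vtx; G; EdgeList; EdgeSubset; Adj; Walk; IsSpanningTree; NumSpanningTrees)

-- A graph on A, given by its adjacency relation (symmetric in all uses).
Graph : Set → Set₁
Graph A = Rel A 0ℓ

module _ {A : Set} where

  -- A cycle: distinct x, x₁, …, x_k (k ≥ 2), consecutive ones adjacent and
  -- x_k adjacent to x.  For R = Adj E S this is literally Defs.HasCycle.
  Cycle : Graph A → Set
  Cycle R = Σ A λ x → Σ (List A) λ xs →
    (2 ≤ length xs) × Unique (x ∷ xs) × Linked R (x ∷ xs ++ [ x ])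

  Tree : Graph A → Set
  Tree R = (∀ u v → Star R u v) × ¬ Cycle R

  TwoTrees : Graph A → A → A → Set
  TwoTrees R a b = ¬ Cycle R × ¬ Star R a b × (∀ x → Star R x a ⊎ Star R x b)

  Cycle-map : ∀ {R R′ : Graph A} → R ⇒ R′ → Cycle R → Cycle R′
  Cycle-map f (x , xs , long , distinct , linked) = x , xs , long , distinct , Linked.map f linked

  Tree-resp : ∀ {R R′ : Graph A} → R ⇒ R′ → R′ ⇒ R → Tree R → Tree R′
  Tree-resp f g (conn , acyclic) = (λ u v → Star.map f (conn u v)) , (λ c → acyclic (Cycle-map g c))

  TwoTrees-resp : ∀ {R R′ : Graph A} {a b} → R ⇒ R′ → R′ ⇒ R → TwoTrees R a b → TwoTrees R′ a b
  TwoTrees-resp f g (acyclic , apart , reach) =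
    (λ c → acyclic (Cycle-map g c)) , (λ w → apart (Star.map g w)) ,
    λ x → Sum.map (Star.map f) (Star.map f) (reach x)

  reach-two⇒TwoTrees : ∀ {R : Graph A} {a b} → Symmetric R → ¬ Cycle R →
    (∀ x → Star R x a ⊎ Star R x b) → ¬ Tree R → TwoTrees R a b
  reach-two⇒TwoTrees {R} {a} {b} sym-R acyclic reach notTree =
    acyclic , (λ ab → notTree (connected ab , acyclic)) , reach
    where
    back : ∀ {x y} → Star R x y → Star R y x
    back = Star.reverse sym-R
    connected : Star R a b → ∀ u v → Star R u v
    connected ab u v with reach u | reach v
    ... | inj₁ ua | inj₁ va = ua ◅◅ back va
    ... | inj₁ ua | inj₂ vb = ua ◅◅ ab ◅◅ back vb
    ... | inj₂ ub | inj₁ va = ub ◅◅ back ab ◅◅ back va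
    ... | inj₂ ub | inj₂ vb = ub ◅◅ back vb

-- Mapping a cycle along a graph homomorphism f which is injective on
-- vertices having an outgoing edge (as every vertex of a cycle does).
module _ {A B : Set} {S : Graph A} {R : Graph B} (f : A → B)
         (hom : ∀ {x y} → S x y → R (f x) (f y))
         (inj : ∀ {x y x′ y′} → S x y → S x′ y′ → f x ≡ f x′ → x ≡ x′) where

  private
    sources : ∀ {x xs z} → Linked S (x ∷ xs ++ [ z ]) → All (λ a → Σ A (S a)) (x ∷ xs)
    sources {xs = []} (e ∷ [-]) = (_ , e) All.∷ All.[]
    sources {xs = _ ∷ _} (e ∷ k) = (_ , e) All.∷ sources k

    unique-map : ∀ {l} → All (λ a → Σ A (S a)) l → Unique l → Unique (map f l)
    unique-map All.[] AllPairs.[] = AllPairs.[]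
    unique-map ((_ , e) All.∷ es) (a∉ ∷ u) =
      AllP.map⁺ (All.zipWith (λ ((_ , e′) , a≢) fa≡ → a≢ (inj e e′ fa≡)) (es , a∉)) ∷ unique-map es u

  Cycle-gmap : Cycle S → Cycle R
  Cycle-gmap (x , xs , long , distinct , links) =
    f x , map f xs , subst (2 ≤_) (sym (length-map f xs)) long ,
    unique-map (sources links) distinct ,
    subst (λ l → Linked R (f x ∷ l)) (map-++ f xs [ x ]) (LinkedP.map⁺ (Linked.map hom links))

-- Adding one edge u — v to a graph.

module _ {A : Set} where

  Edge : A → A → Graph A
  Edge u v x y = (x ≡ u × y ≡ v) ⊎ (x ≡ v × y ≡ u)

  Edge-sym : ∀ {u v} → Symmetric (Edge u v)
  Edge-sym (inj₁ (p , q)) = inj₂ (q , p)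
  Edge-sym (inj₂ (p , q)) = inj₁ (q , p)

  walk-split : ∀ {R : Graph A} {u v x y} → Star (R ∪ Edge u v) x y →
    Star R x y ⊎ (Star R x u × Star R v y) ⊎ (Star R x v × Star R u y)
  walk-split ε = inj₁ ε
  walk-split (inj₁ r ◅ p) with walk-split p
  ... | inj₁ q = inj₁ (r ◅ q)
  ... | inj₂ (inj₁ (q , q′)) = inj₂ (inj₁ (r ◅ q , q′))
  ... | inj₂ (inj₂ (q , q′)) = inj₂ (inj₂ (r ◅ q , q′))
  walk-split (inj₂ (inj₁ (refl , refl)) ◅ p) with walk-split p
  ... | inj₁ q = inj₂ (inj₁ (ε , q))
  ... | inj₂ (inj₁ (_ , q′)) = inj₂ (inj₁ (ε , q′))
  ... | inj₂ (inj₂ (_ , q′)) = inj₁ q′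
  walk-split (inj₂ (inj₂ (refl , refl)) ◅ p) with walk-split p
  ... | inj₁ q = inj₂ (inj₂ (ε , q))
  ... | inj₂ (inj₁ (_ , q′)) = inj₁ q′
  ... | inj₂ (inj₂ (_ , q′)) = inj₂ (inj₂ (ε , q′))

  edge-ends : ∀ {u v a b c d : A} → Edge u v a b → Edge u v c d →
    (a ≡ c × b ≡ d) ⊎ (a ≡ d × b ≡ c)
  edge-ends (inj₁ (refl , refl)) (inj₁ (refl , refl)) = inj₁ (refl , refl)
  edge-ends (inj₁ (refl , refl)) (inj₂ (refl , refl)) = inj₂ (refl , refl)
  edge-ends (inj₂ (refl , refl)) (inj₁ (refl , refl)) = inj₂ (refl , refl)
  edge-ends (inj₂ (refl , refl)) (inj₂ (refl , refl)) = inj₁ (refl , refl)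

  lastOf : A → List A → A
  lastOf y [] = y
  lastOf y (z ∷ l) = lastOf z l

  lastOf-∈ : ∀ y l → lastOf y l ∈ y ∷ l
  lastOf-∈ y [] = here refl
  lastOf-∈ y (z ∷ l) = there (lastOf-∈ z l)

  lastOf-++ : ∀ (y : A) pre a l → lastOf y (pre ++ a ∷ l) ≡ lastOf a l
  lastOf-++ y [] a l = refl
  lastOf-++ y (p ∷ pre) a l = lastOf-++ p pre a l

  lastOf-suffix : ∀ pre (y : A) l a m → y ∷ l ≡ pre ++ a ∷ m → lastOf y l ≡ lastOf a m
  lastOf-suffix [] y l a m refl = refl
  lastOf-suffix (p ∷ pre) y l a m refl = lastOf-++ p pre a m

  linked⇒walk : ∀ {R : Graph A} {y l} → Linked R (y ∷ l) → Star R y (lastOf y l)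
  linked⇒walk [-] = ε
  linked⇒walk (r ∷ k) = r ◅ linked⇒walk k

  linked-snoc : ∀ {R : Graph A} {y l x} → Linked R (y ∷ l) → R (lastOf y l) x → Linked R (y ∷ l ++ [ x ])
  linked-snoc [-] r = r ∷ [-]
  linked-snoc (r′ ∷ k) r = r′ ∷ linked-snoc k r

  linked-unsnoc : ∀ {R : Graph A} {y l x} → Linked R (y ∷ l ++ [ x ]) → Linked R (y ∷ l) × R (lastOf y l) x
  linked-unsnoc {l = []} (r ∷ [-]) = [-] , r
  linked-unsnoc {l = z ∷ l} (r ∷ k) = Product.map₁ (r ∷_) (linked-unsnoc {l = l} k)

  linked-suffix : ∀ {R : Graph A} pre {l} → Linked R (pre ++ l) → Linked R l
  linked-suffix [] k = k
  linked-suffix (p ∷ pre) k = linked-suffix pre (Linked.tail k)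

  unique-suffix : ∀ pre {l : List A} → Unique (pre ++ l) → Unique l
  unique-suffix [] u = u
  unique-suffix (p ∷ pre) (_ ∷ u) = unique-suffix pre u

  head∉tail : ∀ {x : A} {xs} → Unique (x ∷ xs) → x ∉ xs
  head∉tail (x∉ ∷ _) = All¬⇒¬Any x∉

  record UsesNewEdge (R : Graph A) (u v y : A) (l : List A) : Set where
    constructor usesNewEdge
    field
      {a b} : A
      pre rest : List A
      new : Edge u v a b
      before : Star R y a
      after : Linked R (b ∷ rest)
      shape : y ∷ l ≡ pre ++ a ∷ b ∷ rest

  -- In a duplicate-free list the new edge occurs at most once: since its
  -- endpoints are distinct list entries, a second use would repeat one.
  split-at-new-edge : ∀ {R : Graph A} {u v} y l → Unique (y ∷ l) → Linked (R ∪ Edge u v) (y ∷ l) →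
    Linked R (y ∷ l) ⊎ UsesNewEdge R u v y l
  split-at-new-edge y [] _ [-] = inj₁ [-]
  split-at-new-edge y (z ∷ l) distinct (link ∷ links)
    with split-at-new-edge z l (unique-suffix [ y ] distinct) links | link
  ... | inj₁ old | inj₁ r = inj₁ (r ∷ old)
  ... | inj₁ old | inj₂ e = inj₂ (usesNewEdge [] l e ε old refl)
  ... | inj₂ (usesNewEdge pre rest e w k eq) | inj₁ r =
        inj₂ (usesNewEdge (y ∷ pre) rest e (r ◅ w) k (cong (y ∷_) eq))
  ... | inj₂ (usesNewEdge {a} {b} pre rest e w k eq) | inj₂ e′ with edge-ends e′ e
  ...   | inj₁ (refl , _) =
          ⊥-elim (head∉tail distinct (subst (a ∈_) (sym eq) (∈-++⁺ʳ pre (here refl))))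
  ...   | inj₂ (refl , _) =
          ⊥-elim (head∉tail distinct (subst (b ∈_) (sym eq) (∈-++⁺ʳ pre (there (here refl)))))

  -- In a cycle x ∷ xs, no consecutive pair a, b of x ∷ xs is the closing
  -- pair {lastOf x xs , x}: x occurs only at the front, and when a = x the
  -- closing pair would be the first link of a list of length ≥ 3.
  not-closing-pair : ∀ {x a b : A} {xs} pre rest → 2 ≤ length xs → Unique (x ∷ xs) →
    x ∷ xs ≡ pre ++ a ∷ b ∷ rest →
    (a ≡ lastOf x xs × b ≡ x) ⊎ (a ≡ x × b ≡ lastOf x xs) → ⊥
  not-closing-pair [] _ _ distinct refl (inj₁ (_ , refl)) = head∉tail distinct (here refl)
  not-closing-pair (_ ∷ pre) _ _ distinct refl (inj₁ (_ , refl)) =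
    head∉tail distinct (∈-++⁺ʳ pre (there (here refl)))
  not-closing-pair (_ ∷ pre) _ _ distinct refl (inj₂ (refl , _)) =
    head∉tail distinct (∈-++⁺ʳ pre (here refl))
  not-closing-pair [] [] (s≤s ()) _ refl (inj₂ _)
  not-closing-pair [] (r ∷ rest) _ (_ ∷ distinct) refl (inj₂ (_ , b≡last)) =
    head∉tail distinct (subst (_∈ r ∷ rest) (sym b≡last) (lastOf-∈ r rest))

  cycle-split : ∀ {R : Graph A} {u v} → Cycle (R ∪ Edge u v) → Cycle R ⊎ Star R u v ⊎ Star R v u
  cycle-split {R} (x , xs , long , distinct , links) with linked-unsnoc {l = xs} links
  ... | path , closing with split-at-new-edge x xs distinct path | closing
  ... | inj₁ old | inj₁ r = inj₁ (x , xs , long , distinct , linked-snoc old r)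
  ... | inj₁ old | inj₂ (inj₁ (refl , refl)) = inj₂ (inj₂ (linked⇒walk old))
  ... | inj₁ old | inj₂ (inj₂ (refl , refl)) = inj₂ (inj₁ (linked⇒walk old))
  ... | inj₂ (usesNewEdge {a} {b} pre rest new before after shape) | inj₁ r = orient new
    where
    around : Star R b a
    around = subst (Star R b) (sym (lastOf-suffix pre x xs a (b ∷ rest) shape)) (linked⇒walk after)
             ◅◅ (r ◅ before)
    orient : ∀ {u v} → Edge u v a b → Cycle R ⊎ Star R u v ⊎ Star R v u
    orient (inj₁ (refl , refl)) = inj₂ (inj₂ around)
    orient (inj₂ (refl , refl)) = inj₂ (inj₁ around)
  ... | inj₂ (usesNewEdge pre rest new _ _ shape) | inj₂ new′ =
        ⊥-elim (not-closing-pair pre rest long distinct shape (edge-ends new new′))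

  Path : Graph A → A → A → Set
  Path R u v = Σ (List A) λ l → Unique (u ∷ l) × Linked R (u ∷ l) × lastOf u l ≡ v

  -- Every walk shortens to a simple path, by cutting at a repeated vertex.
  walk⇒path : DecidableEquality A → ∀ {R : Graph A} {u v} → Star R u v → Path R u v
  walk⇒path _≟_ ε = [] , (All.[] ∷ AllPairs.[]) , [-] , refl
  walk⇒path _≟_ {R} (_◅_ {u} {w} r p) with walk⇒path _≟_ p
  ... | l , distinct , links , ends with DecMembership._∈?_ _≟_ u (w ∷ l)
  ...   | no u∉ = w ∷ l , ¬Any⇒All¬ (w ∷ l) u∉ ∷ distinct , r ∷ links , ends
  ...   | yes u∈ with ∈-∃++ u∈
  ...     | pre , post , eq =
            post , unique-suffix pre (subst Unique eq distinct) ,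
            linked-suffix pre (subst (Linked R) eq links) ,
            trans (sym (lastOf-suffix pre w l u post eq)) ends

  -- A new edge u — v between vertices already joined by a walk closes a cycle
  -- (the simple path has length ≥ 2 as u ≠ v and u — v is not an old edge).
  close-cycle : DecidableEquality A → ∀ {R : Graph A} {u v} → ¬ u ≡ v → ¬ R u v → Star R u v →
    Cycle (R ∪ Edge u v)
  close-cycle _≟_ {R} {u} u≢v notEdge walk with walk⇒path _≟_ walk
  ... | [] , _ , _ , refl = ⊥-elim (u≢v refl)
  ... | _ ∷ [] , _ , r ∷ [-] , refl = ⊥-elim (notEdge r)
  ... | z ∷ z′ ∷ l , distinct , links , ends =
        u , z ∷ z′ ∷ l , s≤s (s≤s z≤n) , distinct ,
        linked-snoc (Linked.map inj₁ links) (inj₂ (inj₂ (ends , refl)))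

data State : Set where
  tree twoTrees dead : State

_≟ˢ_ : DecidableEquality State
tree ≟ˢ tree = yes refl
tree ≟ˢ twoTrees = no λ ()
tree ≟ˢ dead = no λ ()
twoTrees ≟ˢ tree = no λ ()
twoTrees ≟ˢ twoTrees = yes refl
twoTrees ≟ˢ dead = no λ ()
dead ≟ˢ tree = no λ ()
dead ≟ˢ twoTrees = no λ ()
dead ≟ˢ dead = yes refl

Meaning : {A : Set} → State → Graph A → A → A → Set
Meaning tree R a b = Tree R
Meaning twoTrees R a b = TwoTrees R a b
Meaning dead R a b = ¬ Tree R × ¬ TwoTrees R a b

Meaning-resp : ∀ {A} s {R R′ : Graph A} {a b} → R ⇒ R′ → R′ ⇒ R → Meaning s R a b → Meaning s R′ a b
Meaning-resp tree f g m = Tree-resp f g m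
Meaning-resp twoTrees f g m = TwoTrees-resp f g m
Meaning-resp dead f g (notTree , notTwo) =
  (λ t → notTree (Tree-resp g f t)) , (λ t → notTwo (TwoTrees-resp g f t))

cycle⇒dead : ∀ {A} {R : Graph A} {a b} → Cycle R → Meaning dead R a b
cycle⇒dead c = (λ t → proj₂ t c) , (λ t → proj₁ t c)

tree-state : ∀ {A} s {R : Graph A} {a b} → Meaning s R a b → Tree R → s ≡ tree
tree-state tree _ _ = refl
tree-state twoTrees (_ , apart , _) (connected , _) = ⊥-elim (apart (connected _ _))
tree-state dead (notTree , _) t = ⊥-elim (notTree t)

-- Following the components of four terminal vertices t₀ … t₃ while edges
-- between them are added (a union-find on four elements).

Terminal : Set
Terminal = Fin 4

pattern t₀ = zero
pattern t₁ = suc zero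
pattern t₂ = suc (suc zero)
pattern t₃ = suc (suc (suc zero))

-- π k names the component of terminal k.
Labelling : Set
Labelling = Terminal → Terminal

merge : Labelling → Terminal × Terminal → Labelling
merge π (u , v) k = if does (π k ≟ᶠ π v) then π u else π k

merge-joined : ∀ π {u v} k → π k ≡ π v → merge π (u , v) k ≡ π u
merge-joined π {v = v} k eq with π k ≟ᶠ π v
... | yes _ = refl
... | no neq = ⊥-elim (neq eq)

merge-kept : ∀ π {u v} k → ¬ π k ≡ π v → merge π (u , v) k ≡ π k
merge-kept π {v = v} k neq with π k ≟ᶠ π v
... | yes eq = ⊥-elim (neq eq)
... | no _ = refl

Attached : Labelling → Terminal → Set
Attached π k = π k ≡ π t₀ ⊎ π k ≡ π t₁

attached? : ∀ π k → Dec (Attached π k)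
attached? π k = (π k ≟ᶠ π t₀) ⊎-dec (π k ≟ᶠ π t₁)

-- The state read off a final labelling, assuming every vertex reaches a
-- terminal: t₂ and t₃ must be attached, and t₀, t₁ joined or not.
classify : Labelling → State
classify π with attached? π t₂ | attached? π t₃ | π t₀ ≟ᶠ π t₁
... | yes _ | yes _ | yes _ = tree
... | yes _ | yes _ | no _ = twoTrees
... | _ | _ | _ = dead

-- Adding the edges in order; an edge inside one component closes a cycle.
runEdges : Labelling → List (Terminal × Terminal) → State
runEdges π [] = classify π
runEdges π ((u , v) ∷ es) with π u ≟ᶠ π v
... | yes _ = dead
... | no _ = runEdges (merge π (u , v)) es

Simple : List (Terminal × Terminal) → Set
Simple es = AllPairs (λ (u , v) (u′ , v′) → ¬ Edge u v u′ v′) es × All (λ (u , v) → ¬ u ≡ v) es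

simple? : ∀ es → Dec (Simple es)
simple? es =
  allPairs? (λ (u , v) (u′ , v′) → ¬? (edge? u v u′ v′)) es ×-dec
  All.all? (λ (u , v) → ¬? (u ≟ᶠ v)) es
  where
  edge? : ∀ u v x y → Dec (Edge u v x y)
  edge? u v x y = ((x ≟ᶠ u) ×-dec (y ≟ᶠ v)) ⊎-dec ((x ≟ᶠ v) ×-dec (y ≟ᶠ u))

module Terminals {A : Set} (_≟ᴬ_ : DecidableEquality A) (ι : Terminal → A) where

  addEdges : Graph A → List (Terminal × Terminal) → Graph A
  addEdges R [] = R
  addEdges R ((u , v) ∷ es) = addEdges (R ∪ Edge (ι u) (ι v)) es

  addEdges-⊇ : ∀ {R} es → R ⇒ addEdges R es
  addEdges-⊇ [] r = r
  addEdges-⊇ (e ∷ es) r = addEdges-⊇ es (inj₁ r)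

  EdgeIn : List (Terminal × Terminal) → Graph A
  EdgeIn es x y = Σ (Terminal × Terminal) λ e → e ∈ es × Edge (ι (proj₁ e)) (ι (proj₂ e)) x y

  addEdges-split : ∀ {R} es {x y} → addEdges R es x y → R x y ⊎ EdgeIn es x y
  addEdges-split [] r = inj₁ r
  addEdges-split (e ∷ es) r with addEdges-split es r
  ... | inj₁ (inj₁ r′) = inj₁ r′
  ... | inj₁ (inj₂ new) = inj₂ (e , here refl , new)
  ... | inj₂ (k , m , new) = inj₂ (k , there m , new)

  addEdges-∋ : ∀ {R} es {x y} → EdgeIn es x y → addEdges R es x y
  addEdges-∋ (e ∷ es) (_ , here refl , new) = addEdges-⊇ es (inj₂ new)
  addEdges-∋ (e ∷ es) (k , there m , new) = addEdges-∋ es (k , m , new)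

  record Tracks (R : Graph A) (π : Labelling) : Set where
    field
      walk⇒same : ∀ i j → Star R (ι i) (ι j) → π i ≡ π j
      same⇒walk : ∀ i j → π i ≡ π j → Star R (ι i) (ι j)
      reaches : ∀ x → Σ Terminal λ i → Star R x (ι i)
      acyclic : ¬ Cycle R

  Tracks-merge : ∀ {R π u v} → Tracks R π → ¬ π u ≡ π v →
    Tracks (R ∪ Edge (ι u) (ι v)) (merge π (u , v))
  Tracks-merge {R} {π} {u} {v} tr π≢ = record
    { walk⇒same = walk⇒same′ ; same⇒walk = same⇒walk′ ; reaches = reaches′ ; acyclic = acyclic′ }
    where
    open Tracks tr
    R′ : Graph A
    R′ = R ∪ Edge (ι u) (ι v)
    old : ∀ {x y} → Star R x y → Star R′ x y
    old = Star.map inj₁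
    new : Star R′ (ι u) (ι v)
    new = inj₂ (inj₁ (refl , refl)) ◅ ε
    new⁻¹ : Star R′ (ι v) (ι u)
    new⁻¹ = inj₂ (inj₂ (refl , refl)) ◅ ε
    walk⇒same′ : ∀ i j → Star R′ (ι i) (ι j) → merge π (u , v) i ≡ merge π (u , v) j
    walk⇒same′ i j w with walk-split w
    ... | inj₁ p = cong (λ l → if does (l ≟ᶠ π v) then π u else l) (walk⇒same i j p)
    ... | inj₂ (inj₁ (p , q)) =
          let iu = walk⇒same i u p ; vj = walk⇒same v j q in
          trans (merge-kept π i (λ e → π≢ (trans (sym iu) e)))
                (trans iu (sym (merge-joined π j (sym vj))))
    ... | inj₂ (inj₂ (p , q)) =
          let iv = walk⇒same i v p ; uj = walk⇒same u j q in
          trans (merge-joined π i iv)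
                (trans uj (sym (merge-kept π j (λ e → π≢ (trans uj e)))))
    same⇒walk′ : ∀ i j → merge π (u , v) i ≡ merge π (u , v) j → Star R′ (ι i) (ι j)
    -- split on whether i and j were in v's component; eq then equates their
    -- labels in π after relabelling, which joins i and j through the new edge
    same⇒walk′ i j eq with π i ≟ᶠ π v | π j ≟ᶠ π v
    ... | yes iv | yes jv = old (same⇒walk i j (trans iv (sym jv)))
    ... | yes iv | no _ = old (same⇒walk i v iv) ◅◅ new⁻¹ ◅◅ old (same⇒walk u j eq)
    ... | no _ | yes jv = old (same⇒walk i u eq) ◅◅ new ◅◅ old (same⇒walk v j (sym jv))
    ... | no _ | no _ = old (same⇒walk i j eq)
    reaches′ : ∀ x → Σ Terminal λ i → Star R′ x (ι i)
    reaches′ x = Product.map₂ old (reaches x)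
    acyclic′ : ¬ Cycle R′
    acyclic′ c with cycle-split c
    ... | inj₁ c′ = acyclic c′
    ... | inj₂ (inj₁ w) = π≢ (walk⇒same u v w)
    ... | inj₂ (inj₂ w) = π≢ (sym (walk⇒same v u w))

  module _ {R : Graph A} {π : Labelling} (sym-R : Symmetric R) (tr : Tracks R π) where
    open Tracks tr

    attached⇒walk : ∀ k → Attached π k → Star R (ι k) (ι t₀) ⊎ Star R (ι k) (ι t₁)
    attached⇒walk k (inj₁ e) = inj₁ (same⇒walk k t₀ e)
    attached⇒walk k (inj₂ e) = inj₂ (same⇒walk k t₁ e)

    walk⇒attached : ∀ k → Star R (ι k) (ι t₀) ⊎ Star R (ι k) (ι t₁) → Attached π k
    walk⇒attached k (inj₁ w) = inj₁ (walk⇒same k t₀ w)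
    walk⇒attached k (inj₂ w) = inj₂ (walk⇒same k t₁ w)

    unattached⇒dead : ∀ {k} → ¬ Attached π k → Meaning dead R (ι t₀) (ι t₁)
    unattached⇒dead {k} notAttached =
      (λ t → notAttached (walk⇒attached k (inj₁ (proj₁ t _ _)))) ,
      (λ t → notAttached (walk⇒attached k (proj₂ (proj₂ t) _)))

    reach-two : Attached π t₂ → Attached π t₃ → ∀ x → Star R x (ι t₀) ⊎ Star R x (ι t₁)
    reach-two a₂ a₃ x with reaches x
    ... | t₀ , w = inj₁ w
    ... | t₁ , w = inj₂ w
    ... | t₂ , w = Sum.map (w ◅◅_) (w ◅◅_) (attached⇒walk t₂ a₂)
    ... | t₃ , w = Sum.map (w ◅◅_) (w ◅◅_) (attached⇒walk t₃ a₃)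

    classify-correct : Meaning (classify π) R (ι t₀) (ι t₁)
    classify-correct with attached? π t₂ | attached? π t₃ | π t₀ ≟ᶠ π t₁
    ... | yes a₂ | yes a₃ | yes joined = connected , acyclic
      where
      connected : ∀ x y → Star R x y
      connected x y with reach-two a₂ a₃ x | reach-two a₂ a₃ y
      ... | inj₁ p | inj₁ q = p ◅◅ Star.reverse sym-R q
      ... | inj₁ p | inj₂ q = p ◅◅ same⇒walk t₀ t₁ joined ◅◅ Star.reverse sym-R q
      ... | inj₂ p | inj₁ q = p ◅◅ same⇒walk t₁ t₀ (sym joined) ◅◅ Star.reverse sym-R q
      ... | inj₂ p | inj₂ q = p ◅◅ Star.reverse sym-R q
    ... | yes a₂ | yes a₃ | no apart =
          acyclic , (λ w → apart (walk⇒same t₀ t₁ w)) , reach-two a₂ a₃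
    ... | no n₂ | _ | _ = unattached⇒dead n₂
    ... | yes _ | no n₃ | _ = unattached⇒dead n₃

  -- The side conditions under which an inserted edge inside a component
  -- really closes a cycle: it is not a loop and not already present.
  Fresh : Graph A → List (Terminal × Terminal) → Set
  Fresh R [] = ⊤
  Fresh R ((u , v) ∷ es) = ¬ R (ι u) (ι v) × ¬ ι u ≡ ι v × Fresh (R ∪ Edge (ι u) (ι v)) es

  runEdges-correct : ∀ es {R π} → Symmetric R → Tracks R π → Fresh R es →
    Meaning (runEdges π es) (addEdges R es) (ι t₀) (ι t₁)
  runEdges-correct [] sym-R tr _ = classify-correct sym-R tr
  runEdges-correct ((u , v) ∷ es) {R} {π} sym-R tr (notEdge , notLoop , fresh) with π u ≟ᶠ π v
  ... | yes joined = cycle⇒dead (Cycle-map (addEdges-⊇ es)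
                       (close-cycle _≟ᴬ_ notLoop notEdge (Tracks.same⇒walk tr u v joined)))
  ... | no apart = runEdges-correct es (∪-symmetric {L = R} sym-R Edge-sym)
                     (Tracks-merge {u = u} {v} tr apart) fresh

  Fresh-intro : (∀ {i j} → ι i ≡ ι j → i ≡ j) → ∀ {R} es → Simple es →
    All (λ (u , v) → ¬ R (ι u) (ι v)) es → Fresh R es
  Fresh-intro inj [] _ _ = tt
  Fresh-intro inj {R} ((u , v) ∷ es)
    (distinct ∷ distincts , notLoop All.∷ notLoops) (notEdge All.∷ notEdges) =
    notEdge , (λ e → notLoop (inj e)) ,
    Fresh-intro inj es (distincts , notLoops) (All.zipWith still-new (distinct , notEdges))
    where
    still-new : ∀ {e} → ¬ Edge u v (proj₁ e) (proj₂ e) × ¬ R (ι (proj₁ e)) (ι (proj₂ e)) →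
      ¬ (R ∪ Edge (ι u) (ι v)) (ι (proj₁ e)) (ι (proj₂ e))
    still-new (_ , old) (inj₁ r) = old r
    still-new (notSame , _) (inj₂ (inj₁ (p , q))) = notSame (inj₁ (inj p , inj q))
    still-new (notSame , _) (inj₂ (inj₂ (p , q))) = notSame (inj₂ (inj p , inj q))

-- The chain.  Columns are added on the left: G_(n+1) consists of G_n
-- shifted one column to the right, a new column 0 = {0 , 0′}, and five
-- local edges 0 — 0′, 0 — 1, 0′ — 1′, 0 — 1′, 0′ — 1.

Pair : ℕ → Set
Pair n = Vtx n × Vtx n

_≟ⱽ_ : ∀ {n} → DecidableEquality (Vtx n)
_≟ⱽ_ = ≡-dec _≟ᶠ_ BoolP._≟_

a₀ b₀ : ∀ {n} → Vtx n
a₀ = zero , false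
b₀ = zero , true

up : ∀ {n} → Vtx n → Vtx (suc n)
up (i , b) = suc i , b

down : ∀ {n} → Vtx (suc n) → Vtx n
down (zero , b) = zero , b
down (suc i , b) = i , b

data Shift {n} (R : Graph (Vtx n)) : Graph (Vtx (suc n)) where
  shift : ∀ {i b j c} → R (i , b) (j , c) → Shift R (suc i , b) (suc j , c)

Shift-sym : ∀ {n} {R : Graph (Vtx n)} → Symmetric R → Symmetric (Shift R)
Shift-sym sym-R (shift r) = shift (sym-R r)

Star-shift : ∀ {n} {R : Graph (Vtx n)} {x y} → Star R x y → Star (Shift R) (up x) (up y)
Star-shift = Star.gmap up shift

Star-unshift : ∀ {n} {R : Graph (Vtx n)} {x y} → Star (Shift R) x y → Star R (down x) (down y)
Star-unshift = Star.gmap down λ { (shift r) → r }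

Cycle-shift : ∀ {n} {R : Graph (Vtx n)} → Cycle R → Cycle (Shift R)
Cycle-shift = Cycle-gmap up shift λ { _ _ refl → refl }

Cycle-unshift : ∀ {n} {R : Graph (Vtx n)} → Cycle (Shift R) → Cycle R
Cycle-unshift = Cycle-gmap down (λ { (shift r) → r }) λ { (shift _) (shift _) refl → refl }

column₀-isolated : ∀ {n} {R : Graph (Vtx n)} {b z} → Star (Shift R) (zero , b) z → (zero , b) ≡ z
column₀-isolated ε = refl
column₀-isolated (() ◅ _)

terminal : ∀ {n} → Terminal → Vtx (suc n)
terminal t₀ = zero , false
terminal t₁ = zero , true
terminal t₂ = suc zero , false
terminal t₃ = suc zero , true

terminal⁻¹ : ∀ {n} → Vtx (suc n) → Terminal
terminal⁻¹ (zero , false) = t₀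
terminal⁻¹ (zero , true) = t₁
terminal⁻¹ (suc _ , false) = t₂
terminal⁻¹ (suc _ , true) = t₃

terminal⁻¹-terminal : ∀ {n} i → terminal⁻¹ (terminal {n} i) ≡ i
terminal⁻¹-terminal t₀ = refl
terminal⁻¹-terminal t₁ = refl
terminal⁻¹-terminal t₂ = refl
terminal⁻¹-terminal t₃ = refl

terminal-injective : ∀ {n i j} → terminal {n} i ≡ terminal j → i ≡ j
terminal-injective {i = i} {j} eq =
  trans (sym (terminal⁻¹-terminal i)) (trans (cong terminal⁻¹ eq) (terminal⁻¹-terminal j))

up≡terminal : ∀ {n} {x : Vtx n} k → up x ≡ terminal k → x ≡ a₀ ⊎ x ≡ b₀
up≡terminal t₂ refl = inj₁ refl
up≡terminal t₃ refl = inj₂ refl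

module Local {n : ℕ} = Terminals (_≟ⱽ_ {suc n}) terminal
open Local using (addEdges; addEdges-⊇; addEdges-split; addEdges-∋; Tracks; Fresh)

-- Encoding spanning subgraphs by bit strings.

-- Bits for the local edges 0 — 0′, 0 — 1, 0′ — 1′, 0 — 1′, 0′ — 1.
LocalBits : Set
LocalBits = Bool × Bool × Bool × Bool × Bool

-- One bit for the vertical edge of G_0, five more per added column.
Bits : ℕ → Set
Bits zero = Bool
Bits (suc n) = LocalBits × Bits n

keep : {X : Set} → Bool → X → List X → List X
keep b x l = if b then x ∷ l else l

keep-∈⁻ : ∀ {X : Set} b {x y : X} {l} → y ∈ keep b x l → (b ≡ true × y ≡ x) ⊎ y ∈ l
keep-∈⁻ true (here refl) = inj₁ (refl , refl)
keep-∈⁻ true (there m) = inj₂ m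
keep-∈⁻ false m = inj₂ m

keep-∈⁺ : ∀ {X : Set} b {x y : X} {l} → y ∈ l → y ∈ keep b x l
keep-∈⁺ true m = there m
keep-∈⁺ false m = m

localEdges : LocalBits → List (Terminal × Terminal)
localEdges (v , r₁ , r₂ , r₃ , r₄) =
  keep v (t₀ , t₁) (keep r₁ (t₀ , t₂) (keep r₂ (t₁ , t₃) (keep r₃ (t₀ , t₃) (keep r₄ (t₁ , t₂) []))))

selected : ∀ n → Bits n → Pair n → Bool
selected zero v ((zero , false) , (zero , true)) = v
selected zero _ _ = false
selected (suc n) ((v , _ , _ , _ , _) , _) ((zero , false) , (zero , true)) = v
selected (suc n) ((_ , r₁ , _ , _ , _) , _) ((zero , false) , (suc zero , false)) = r₁
selected (suc n) ((_ , _ , r₂ , _ , _) , _) ((zero , true) , (suc zero , true)) = r₂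
selected (suc n) ((_ , _ , _ , r₃ , _) , _) ((zero , false) , (suc zero , true)) = r₃
selected (suc n) ((_ , _ , _ , _ , r₄) , _) ((zero , true) , (suc zero , false)) = r₄
selected (suc n) (_ , β) ((suc i , b) , (suc j , c)) = selected n β ((i , b) , (j , c))
selected (suc n) _ _ = false

Chosen : ∀ n → Bits n → Graph (Vtx n)
Chosen n β x y = selected n β (x , y) ≡ true ⊎ selected n β (y , x) ≡ true

Chosen-sym : ∀ n β → Symmetric (Chosen n β)
Chosen-sym _ _ (inj₁ s) = inj₂ s
Chosen-sym _ _ (inj₂ s) = inj₁ s

data LocalEdge : LocalBits → Terminal × Terminal → Set where
  vertical₀ : ∀ {r₁ r₂ r₃ r₄} → LocalEdge (true , r₁ , r₂ , r₃ , r₄) (t₀ , t₁)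
  rung₁ : ∀ {v r₂ r₃ r₄} → LocalEdge (v , true , r₂ , r₃ , r₄) (t₀ , t₂)
  rung₂ : ∀ {v r₁ r₃ r₄} → LocalEdge (v , r₁ , true , r₃ , r₄) (t₁ , t₃)
  rung₃ : ∀ {v r₁ r₂ r₄} → LocalEdge (v , r₁ , r₂ , true , r₄) (t₀ , t₃)
  rung₄ : ∀ {v r₁ r₂ r₃} → LocalEdge (v , r₁ , r₂ , r₃ , true) (t₁ , t₂)

localEdge⁺ : ∀ {lb k} → LocalEdge lb k → k ∈ localEdges lb
localEdge⁺ vertical₀ = here refl
localEdge⁺ (rung₁ {v}) = keep-∈⁺ v (here refl)
localEdge⁺ (rung₂ {v} {r₁}) = keep-∈⁺ v (keep-∈⁺ r₁ (here refl))
localEdge⁺ (rung₃ {v} {r₁} {r₂}) = keep-∈⁺ v (keep-∈⁺ r₁ (keep-∈⁺ r₂ (here refl)))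
localEdge⁺ (rung₄ {v} {r₁} {r₂} {r₃}) = keep-∈⁺ v (keep-∈⁺ r₁ (keep-∈⁺ r₂ (keep-∈⁺ r₃ (here refl))))

localEdge⁻ : ∀ lb {k} → k ∈ localEdges lb → LocalEdge lb k
localEdge⁻ (v , r₁ , r₂ , r₃ , r₄) m with keep-∈⁻ v m
... | inj₁ (refl , refl) = vertical₀
... | inj₂ m₁ with keep-∈⁻ r₁ m₁
...   | inj₁ (refl , refl) = rung₁
...   | inj₂ m₂ with keep-∈⁻ r₂ m₂
...     | inj₁ (refl , refl) = rung₂
...     | inj₂ m₃ with keep-∈⁻ r₃ m₃
...       | inj₁ (refl , refl) = rung₃
...       | inj₂ m₄ with keep-∈⁻ r₄ m₄
...         | inj₁ (refl , refl) = rung₄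
...         | inj₂ ()

local-selected : ∀ {n lb β u v} → LocalEdge lb (u , v) →
  selected (suc n) (lb , β) (terminal u , terminal v) ≡ true
local-selected vertical₀ = refl
local-selected rung₁ = refl
local-selected rung₂ = refl
local-selected rung₃ = refl
local-selected rung₄ = refl

data SelectedView {n} (lb : LocalBits) (β : Bits n) : Pair (suc n) → Set where
  local : ∀ {u v} → LocalEdge lb (u , v) → SelectedView lb β (terminal u , terminal v)
  shifted : ∀ {i b j c} → selected n β ((i , b) , (j , c)) ≡ true →
    SelectedView lb β ((suc i , b) , (suc j , c))

selected-view : ∀ {n} lb β e → selected (suc n) (lb , β) e ≡ true → SelectedView lb β e
selected-view _ _ ((zero , false) , (zero , false)) ()
selected-view (_ , _) _ ((zero , false) , (zero , true)) refl = local vertical₀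
selected-view (_ , _ , _) _ ((zero , false) , (suc zero , false)) refl = local rung₁
selected-view (_ , _ , _ , _ , _) _ ((zero , false) , (suc zero , true)) refl = local rung₃
selected-view _ _ ((zero , false) , (suc (suc _) , _)) ()
selected-view _ _ ((zero , true) , (zero , false)) ()
selected-view _ _ ((zero , true) , (zero , true)) ()
selected-view (_ , _ , _ , _) _ ((zero , true) , (suc zero , true)) refl = local rung₂
selected-view (_ , _ , _ , _ , _) _ ((zero , true) , (suc zero , false)) refl = local rung₄
selected-view _ _ ((zero , true) , (suc (suc _) , _)) ()
selected-view _ _ ((suc _ , _) , (zero , _)) ()
selected-view _ _ ((suc _ , _) , (suc _ , _)) s = shifted s

chosen⇒added : ∀ {n} lb β → Chosen (suc n) (lb , β) ⇒ addEdges (Shift (Chosen n β)) (localEdges lb)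
chosen⇒added lb β {x} {y} (inj₁ s) with selected-view lb β (x , y) s
... | local l = addEdges-∋ (localEdges lb) (_ , localEdge⁺ l , inj₁ (refl , refl))
... | shifted s′ = addEdges-⊇ (localEdges lb) (shift (inj₁ s′))
chosen⇒added lb β {x} {y} (inj₂ s) with selected-view lb β (y , x) s
... | local l = addEdges-∋ (localEdges lb) (_ , localEdge⁺ l , inj₂ (refl , refl))
... | shifted s′ = addEdges-⊇ (localEdges lb) (shift (inj₂ s′))

added⇒chosen : ∀ {n} lb β → addEdges (Shift (Chosen n β)) (localEdges lb) ⇒ Chosen (suc n) (lb , β)
added⇒chosen lb β r with addEdges-split (localEdges lb) r
... | inj₁ (shift (inj₁ s)) = inj₁ s
... | inj₁ (shift (inj₂ s)) = inj₂ s
... | inj₂ (_ , m , inj₁ (refl , refl)) = inj₁ (local-selected (localEdge⁻ lb m))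
... | inj₂ (_ , m , inj₂ (refl , refl)) = inj₂ (local-selected (localEdge⁻ lb m))

-- Terminal labellings right after shifting G_n: t₀, t₁ are new and
-- isolated; t₂, t₃ are joined if G_n was a tree and apart if it was a
-- two-tree forest.
πtree πtwo : Labelling
πtree t₀ = t₀
πtree t₁ = t₁
πtree t₂ = t₂
πtree t₃ = t₂
πtwo k = k

-- The state of G_(n+1) from that of G_n and the five new bits: a live G_n
-- is tracked by πtree or πtwo after shifting, a dead one stays dead.
step : State → LocalBits → State
step tree lb = runEdges πtree (localEdges lb)
step twoTrees lb = runEdges πtwo (localEdges lb)
step dead _ = dead

state : ∀ n → Bits n → State
state zero true = tree
state zero false = twoTrees
state (suc n) (lb , β) = step (state n β) lb

module _ {n} {R : Graph (Vtx n)} (sym-R : Symmetric R) where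

  from-new : ∀ i j → Star (Shift R) (terminal i) (terminal j) → (i ≡ t₀ ⊎ i ≡ t₁) → i ≡ j
  from-new t₀ j w _ = terminal-injective (column₀-isolated w)
  from-new t₁ j w _ = terminal-injective (column₀-isolated w)
  from-new t₂ j w (inj₁ ())
  from-new t₂ j w (inj₂ ())
  from-new t₃ j w (inj₁ ())
  from-new t₃ j w (inj₂ ())

  to-new : ∀ i j → Star (Shift R) (terminal i) (terminal j) → (j ≡ t₀ ⊎ j ≡ t₁) → i ≡ j
  to-new i j w new = sym (from-new j i (Star.reverse (Shift-sym sym-R) w) new)

  Tracks-tree : Tree R → Tracks (Shift R) πtree
  Tracks-tree (connected , acyclic) = record
    { walk⇒same = walk⇒same ; same⇒walk = same⇒walk ; reaches = reaches ; acyclic = acyclic ∘ Cycle-unshift }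
    where
    walk⇒same : ∀ i j → Star (Shift R) (terminal i) (terminal j) → πtree i ≡ πtree j
    walk⇒same t₀ j w = cong πtree (from-new t₀ j w (inj₁ refl))
    walk⇒same t₁ j w = cong πtree (from-new t₁ j w (inj₂ refl))
    walk⇒same i t₀ w = cong πtree (to-new i t₀ w (inj₁ refl))
    walk⇒same i t₁ w = cong πtree (to-new i t₁ w (inj₂ refl))
    walk⇒same t₂ t₂ _ = refl
    walk⇒same t₂ t₃ _ = refl
    walk⇒same t₃ t₂ _ = refl
    walk⇒same t₃ t₃ _ = refl
    same⇒walk : ∀ i j → πtree i ≡ πtree j → Star (Shift R) (terminal i) (terminal j)
    same⇒walk t₀ t₀ _ = ε
    same⇒walk t₁ t₁ _ = ε
    same⇒walk t₂ t₂ _ = ε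
    same⇒walk t₃ t₃ _ = ε
    same⇒walk t₂ t₃ _ = Star-shift (connected a₀ b₀)
    same⇒walk t₃ t₂ _ = Star-shift (connected b₀ a₀)
    same⇒walk t₀ t₁ ()
    same⇒walk t₀ t₂ ()
    same⇒walk t₀ t₃ ()
    same⇒walk t₁ t₀ ()
    same⇒walk t₁ t₂ ()
    same⇒walk t₁ t₃ ()
    same⇒walk t₂ t₀ ()
    same⇒walk t₂ t₁ ()
    same⇒walk t₃ t₀ ()
    same⇒walk t₃ t₁ ()
    reaches : ∀ x → Σ Terminal λ i → Star (Shift R) x (terminal i)
    reaches (zero , false) = t₀ , ε
    reaches (zero , true) = t₁ , ε
    reaches (suc i , b) = t₂ , Star-shift (connected (i , b) a₀)

  Tracks-twoTrees : TwoTrees R a₀ b₀ → Tracks (Shift R) πtwo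
  Tracks-twoTrees (acyclic , apart , reach) = record
    { walk⇒same = walk⇒same ; same⇒walk = λ { i .i refl → ε } ; reaches = reaches
    ; acyclic = acyclic ∘ Cycle-unshift }
    where
    walk⇒same : ∀ i j → Star (Shift R) (terminal i) (terminal j) → i ≡ j
    walk⇒same t₀ j w = from-new t₀ j w (inj₁ refl)
    walk⇒same t₁ j w = from-new t₁ j w (inj₂ refl)
    walk⇒same i t₀ w = to-new i t₀ w (inj₁ refl)
    walk⇒same i t₁ w = to-new i t₁ w (inj₂ refl)
    walk⇒same t₂ t₂ _ = refl
    walk⇒same t₂ t₃ w = ⊥-elim (apart (Star-unshift w))
    walk⇒same t₃ t₂ w = ⊥-elim (apart (Star.reverse sym-R (Star-unshift w)))
    walk⇒same t₃ t₃ _ = refl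
    reaches : ∀ x → Σ Terminal λ i → Star (Shift R) x (terminal i)
    reaches (zero , false) = t₀ , ε
    reaches (zero , true) = t₁ , ε
    reaches (suc i , b) with reach (i , b)
    ... | inj₁ w = t₂ , Star-shift w
    ... | inj₂ w = t₃ , Star-shift w

bools : List Bool
bools = true ∷ false ∷ []

allLocalBits : List LocalBits
allLocalBits = cartesianProduct bools (cartesianProduct bools (cartesianProduct bools
                 (cartesianProduct bools bools)))

bools-unique : Unique bools
bools-unique = ((λ ()) All.∷ All.[]) ∷ All.[] ∷ AllPairs.[]

bools-complete : ∀ b → b ∈ bools
bools-complete true = here refl
bools-complete false = there (here refl)

allLocalBits-complete : ∀ lb → lb ∈ allLocalBits
allLocalBits-complete (v , r₁ , r₂ , r₃ , r₄) =
  ∈-cartesianProduct⁺ (bools-complete v) (∈-cartesianProduct⁺ (bools-complete r₁)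
    (∈-cartesianProduct⁺ (bools-complete r₂) (∈-cartesianProduct⁺ (bools-complete r₃) (bools-complete r₄))))

-- Each choice of local edges is simple and starts every edge in the new
-- column; checked by evaluating the decision procedure on all 32 patterns.
Admissible : List (Terminal × Terminal) → Set
Admissible es = Simple es × All (λ (u , _) → u ≡ t₀ ⊎ u ≡ t₁) es

localEdges-admissible : ∀ lb → Admissible (localEdges lb)
localEdges-admissible lb =
  All.lookup (toWitness {a? = All.all? (λ lb → admissible? (localEdges lb)) allLocalBits} tt)
             (allLocalBits-complete lb)
  where
  admissible? : ∀ es → Dec (Admissible es)
  admissible? es = simple? es ×-dec All.all? (λ (u , _) → (u ≟ᶠ t₀) ⊎-dec (u ≟ᶠ t₁)) es

local-fresh : ∀ {n} {R : Graph (Vtx n)} lb → Fresh (Shift R) (localEdges lb)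
local-fresh {R = R} lb with localEdges-admissible lb
... | simple , starts = Local.Fresh-intro terminal-injective (localEdges lb) simple (All.map not-shifted starts)
  where
  not-shifted : ∀ {u v} → u ≡ t₀ ⊎ u ≡ t₁ → ¬ Shift R (terminal u) (terminal v)
  not-shifted (inj₁ refl) ()
  not-shifted (inj₂ refl) ()

reach-self : ∀ {n} {R : Graph (Vtx n)} {x} → x ≡ a₀ ⊎ x ≡ b₀ → Star R x a₀ ⊎ Star R x b₀
reach-self (inj₁ refl) = inj₁ ε
reach-self (inj₂ refl) = inj₂ ε

-- A walk in G_(n+1) from the shifted copy of G_n into column 0 has to pass
-- through the old column 0, so G_n itself connects its start to a₀ or b₀.
leave-shift : ∀ {n lb β x c} → Star (Chosen (suc n) (lb , β)) (up x) (zero , c) →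
  Star (Chosen n β) x a₀ ⊎ Star (Chosen n β) x b₀
leave-shift {lb = lb} {β} {x = i , b} (_◅_ {j = y} r w)
  with addEdges-split (localEdges lb) (chosen⇒added lb β {suc i , b} {y} r)
... | inj₁ (shift r′) = Sum.map (r′ ◅_) (r′ ◅_) (leave-shift w)
... | inj₂ ((u , _) , _ , inj₁ (x≡ , _)) = reach-self (up≡terminal u x≡)
... | inj₂ ((_ , v) , _ , inj₂ (x≡ , _)) = reach-self (up≡terminal v x≡)

-- Once dead, always dead: if G_(n+1) were a tree or a two-tree forest, then
-- G_n would be acyclic with every vertex reaching a₀ or b₀, hence a tree or
-- a two-tree forest itself.
dead-persists : ∀ {n} lb β → Meaning dead (Chosen n β) a₀ b₀ →
  Meaning dead (Chosen (suc n) (lb , β)) a₀ b₀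
dead-persists {n} lb β (notTree , notTwo) =
  (λ (connected , acyclic′) → impossible acyclic′ (λ x → leave-shift (connected (up x) a₀))) ,
  (λ (acyclic′ , _ , reach′) → impossible acyclic′ (λ x → from-column₀ (reach′ (up x))))
  where
  R : Graph (Vtx n)
  R = Chosen n β
  R′ : Graph (Vtx (suc n))
  R′ = Chosen (suc n) (lb , β)
  lift : Cycle R → Cycle R′
  lift c = Cycle-map (added⇒chosen lb β) (Cycle-map (addEdges-⊇ (localEdges lb)) (Cycle-shift c))
  impossible : ¬ Cycle R′ → (∀ x → Star R x a₀ ⊎ Star R x b₀) → ⊥
  impossible acyclic′ reach = notTwo (reach-two⇒TwoTrees (Chosen-sym n β) (acyclic′ ∘ lift) reach notTree)
  from-column₀ : ∀ {x} → Star R′ (up x) a₀ ⊎ Star R′ (up x) b₀ → Star R x a₀ ⊎ Star R x b₀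
  from-column₀ (inj₁ w) = leave-shift w
  from-column₀ (inj₂ w) = leave-shift w

-- G_0 has two vertices, so no cycles and at most the edge 0 — 0′.
no-cycle₀ : ∀ {R : Graph (Vtx 0)} → ¬ Cycle R
no-cycle₀ (_ , [] , () , _)
no-cycle₀ (_ , _ ∷ [] , s≤s () , _)
no-cycle₀ (x , y ∷ z ∷ _ , _ , ((x≢y All.∷ x≢z All.∷ _) ∷ (y≢z All.∷ _) ∷ _) , _) =
  pigeon x y z x≢y x≢z y≢z
  where
  pigeon : ∀ (x y z : Vtx 0) → ¬ x ≡ y → ¬ x ≡ z → ¬ y ≡ z → ⊥
  pigeon (zero , false) (zero , false) _ x≢y _ _ = x≢y refl
  pigeon (zero , true) (zero , true) _ x≢y _ _ = x≢y refl
  pigeon (zero , false) (zero , true) (zero , false) _ x≢z _ = x≢z refl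
  pigeon (zero , false) (zero , true) (zero , true) _ _ y≢z = y≢z refl
  pigeon (zero , true) (zero , false) (zero , true) _ x≢z _ = x≢z refl
  pigeon (zero , true) (zero , false) (zero , false) _ _ y≢z = y≢z refl

no-edge₀ : ∀ {x y} → ¬ Chosen 0 false x y
no-edge₀ {x} {y} (inj₁ s) = unselected x y s
  where
  unselected : ∀ x y → ¬ selected 0 false (x , y) ≡ true
  unselected (zero , false) (zero , false) ()
  unselected (zero , false) (zero , true) ()
  unselected (zero , true) (zero , false) ()
  unselected (zero , true) (zero , true) ()
no-edge₀ {x} {y} (inj₂ s) = no-edge₀ {y} {x} (inj₁ s)

state-correct₀ : ∀ v → Meaning (state 0 v) (Chosen 0 v) a₀ b₀
state-correct₀ true = connected , no-cycle₀
  where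
  connected : ∀ x y → Star (Chosen 0 true) x y
  connected (zero , false) (zero , false) = ε
  connected (zero , false) (zero , true) = inj₁ refl ◅ ε
  connected (zero , true) (zero , false) = inj₂ refl ◅ ε
  connected (zero , true) (zero , true) = ε
state-correct₀ false = no-cycle₀ , (λ { (_◅_ {j = y} r _) → no-edge₀ {a₀} {y} r }) , reach
  where
  reach : ∀ x → Star (Chosen 0 false) x a₀ ⊎ Star (Chosen 0 false) x b₀
  reach (zero , false) = inj₁ ε
  reach (zero , true) = inj₂ ε

extend-correct : ∀ {n} lb β π → Tracks (Shift (Chosen n β)) π →
  Meaning (runEdges π (localEdges lb)) (Chosen (suc n) (lb , β)) a₀ b₀
extend-correct {n} lb β π tr =
  Meaning-resp (runEdges π (localEdges lb)) (added⇒chosen lb β) (chosen⇒added lb β)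
    (Local.runEdges-correct (localEdges lb) (Shift-sym (Chosen-sym n β)) tr (local-fresh lb))

state-correct : ∀ n β → Meaning (state n β) (Chosen n β) a₀ b₀
state-correct zero v = state-correct₀ v
state-correct (suc n) (lb , β) with state n β | state-correct n β
... | tree | t = extend-correct lb β πtree (Tracks-tree (Chosen-sym n β) t)
... | twoTrees | f = extend-correct lb β πtwo (Tracks-twoTrees (Chosen-sym n β) f)
... | dead | d = dead-persists lb β d

vertical : ∀ n → Fin (suc n) → Pair n
vertical n i = (i , false) , (i , true)

rungs : ∀ n → Fin n → List (Pair n)
rungs n i = ((inject₁ i , false) , (suc i , false)) ∷ ((inject₁ i , true) , (suc i , true))
          ∷ ((inject₁ i , false) , (suc i , true)) ∷ ((inject₁ i , true) , (suc i , false)) ∷ []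

vertical-∈G : ∀ {n} i → vertical n i ∈ G n
vertical-∈G {n} i = ∈-++⁺ˡ (∈-map⁺ (vertical n) (∈-allFin i))

rung-∈G : ∀ {n} i {e} → e ∈ rungs n i → e ∈ G n
rung-∈G {n} i m =
  ∈-++⁺ʳ (map (vertical n) (allFin (suc n)))
         (∈-concatMap⁺ (rungs n) (Any.map (λ { refl → m }) (∈-allFin i)))

∈G⁻ : ∀ {n e} → e ∈ G n → (Σ (Fin (suc n)) λ i → e ≡ vertical n i) ⊎ (Σ (Fin n) λ i → e ∈ rungs n i)
∈G⁻ {n} m with ∈-++⁻ (map (vertical n) (allFin (suc n))) m
... | inj₁ m′ = inj₁ (Product.map₂ proj₂ (∈-map⁻ (vertical n) m′))
... | inj₂ m′ = inj₂ (satisfied (∈-concatMap⁻ (rungs n) {xs = allFin n} m′))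

rung-columns : ∀ {n} i {e} → e ∈ rungs n i → proj₁ (proj₁ e) ≡ inject₁ i × proj₁ (proj₂ e) ≡ suc i
rung-columns i (here refl) = refl , refl
rung-columns i (there (here refl)) = refl , refl
rung-columns i (there (there (here refl))) = refl , refl
rung-columns i (there (there (there (here refl)))) = refl , refl

inject₁≢suc : ∀ {n} (i : Fin n) → ¬ inject₁ i ≡ suc i
inject₁≢suc zero ()
inject₁≢suc (suc i) eq = inject₁≢suc i (suc-injective eq)

G-unique : ∀ n → Unique (G n)
G-unique n =
  UniqueP.++⁺ (UniqueP.map⁺ (λ { refl → refl }) (UniqueP.allFin⁺ (suc n)))
              (UniqueP.concat⁺ (AllP.map⁺ (All.universal (λ _ → rungs-unique) (allFin n)))
                               (AllPairsP.map⁺ (AllPairs.map blocks-disjoint (UniqueP.allFin⁺ n))))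
              vertical-not-rung
  where
  rungs-unique : ∀ {i} → Unique (rungs n i)
  rungs-unique = ((λ ()) All.∷ (λ ()) All.∷ (λ ()) All.∷ All.[]) ∷ ((λ ()) All.∷ (λ ()) All.∷ All.[])
               ∷ ((λ ()) All.∷ All.[]) ∷ All.[] ∷ AllPairs.[]
  blocks-disjoint : ∀ {i j} → ¬ i ≡ j → Disjoint (rungs n i) (rungs n j)
  blocks-disjoint i≢j (m , m′) =
    i≢j (suc-injective (trans (sym (proj₂ (rung-columns _ m))) (proj₂ (rung-columns _ m′))))
  vertical-not-rung : Disjoint (map (vertical n) (allFin (suc n))) (concatMap (rungs n) (allFin n))
  vertical-not-rung (m , m′)
    with ∈-map⁻ (vertical n) m | satisfied (∈-concatMap⁻ (rungs n) {xs = allFin n} m′)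
  ... | _ , _ , refl | j , mj =
        inject₁≢suc j (trans (sym (proj₁ (rung-columns j mj))) (proj₂ (rung-columns j mj)))

upPair : ∀ {n} → Pair n → Pair (suc n)
upPair (x , y) = up x , up y

-- Shifting maps edges of G_n to edges of G_(n+1): the rungs of block suc i
-- of G_(n+1) are the shifted rungs of block i of G_n.
shift-∈G : ∀ {n e} → e ∈ G n → upPair e ∈ G (suc n)
shift-∈G m with ∈G⁻ m
... | inj₁ (i , refl) = vertical-∈G (suc i)
... | inj₂ (i , m′) = rung-∈G (suc i) (∈-map⁺ upPair m′)

local-∈G : ∀ {n lb u v} → LocalEdge lb (u , v) → (terminal u , terminal v) ∈ G (suc n)
local-∈G vertical₀ = vertical-∈G zero
local-∈G rung₁ = rung-∈G zero (here refl)
local-∈G rung₂ = rung-∈G zero (there (here refl))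
local-∈G rung₃ = rung-∈G zero (there (there (here refl)))
local-∈G rung₄ = rung-∈G zero (there (there (there (here refl))))

selected⇒∈G : ∀ n β e → selected n β e ≡ true → e ∈ G n
selected⇒∈G zero _ ((zero , false) , (zero , true)) _ = vertical-∈G zero
selected⇒∈G zero _ ((zero , false) , (zero , false)) ()
selected⇒∈G zero _ ((zero , true) , (zero , false)) ()
selected⇒∈G zero _ ((zero , true) , (zero , true)) ()
selected⇒∈G (suc n) (lb , β) e s with selected-view lb β e s
... | local l = local-∈G l
... | shifted s′ = shift-∈G (selected⇒∈G n β _ s′)

bitsOf : ∀ n → (Pair n → Bool) → Bits n
bitsOf zero P = P (vertical 0 zero)
bitsOf (suc n) P =
  (P (terminal t₀ , terminal t₁) , P (terminal t₀ , terminal t₂) , P (terminal t₁ , terminal t₃) ,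
   P (terminal t₀ , terminal t₃) , P (terminal t₁ , terminal t₂)) , bitsOf n (P ∘ upPair)

bitsOf-selected : ∀ n β → bitsOf n (selected n β) ≡ β
bitsOf-selected zero _ = refl
bitsOf-selected (suc n) (lb , β) = cong (lb ,_) (bitsOf-selected n β)

bitsOf-cong : ∀ n {P Q} → (∀ {e} → e ∈ G n → P e ≡ Q e) → bitsOf n P ≡ bitsOf n Q
bitsOf-cong zero agree = agree (vertical-∈G zero)
bitsOf-cong (suc n) agree =
  cong₂ _,_ (cong₂ _,_ (agree (vertical-∈G zero)) (cong₂ _,_ (agree (rung-∈G zero (here refl)))
              (cong₂ _,_ (agree (rung-∈G zero (there (here refl))))
                (cong₂ _,_ (agree (rung-∈G zero (there (there (here refl)))))
                  (agree (rung-∈G zero (there (there (there (here refl))))))))))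
            (bitsOf-cong n (λ m → agree (shift-∈G m)))

selected-bitsOf : ∀ n P {e} → e ∈ G n → selected n (bitsOf n P) e ≡ P e
selected-bitsOf zero P (here refl) = refl
selected-bitsOf (suc n) P m with ∈G⁻ m
... | inj₁ (zero , refl) = refl
... | inj₁ (suc i , refl) = selected-bitsOf n (P ∘ upPair) (vertical-∈G i)
... | inj₂ (zero , here refl) = refl
... | inj₂ (zero , there (here refl)) = refl
... | inj₂ (zero , there (there (here refl))) = refl
... | inj₂ (zero , there (there (there (here refl)))) = refl
... | inj₂ (suc i , m′) with ∈-map⁻ upPair m′
...   | e′ , m″ , refl = selected-bitsOf n (P ∘ upPair) (rung-∈G i m″)

module EdgeSubsets {X : Set} (_≟ˣ_ : DecidableEquality X) where

  subsetOf : (E : List X) → (X → Bool) → Subset (length E)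
  subsetOf E P = tabulate (P ∘ lookup E)

  subsetOf⁻ : ∀ E P {i} → i ∈ₛ subsetOf E P → P (lookup E i) ≡ true
  subsetOf⁻ E P {i} i∈ = trans (sym (lookup∘tabulate (P ∘ lookup E) i)) ([]=⇒lookup i∈)

  subsetOf⁺ : ∀ E P {i} → P (lookup E i) ≡ true → i ∈ₛ subsetOf E P
  subsetOf⁺ E P {i} p = lookup⇒[]= i (subsetOf E P) (trans (lookup∘tabulate (P ∘ lookup E) i) p)

  subsetOf-injective : ∀ E P Q → subsetOf E P ≡ subsetOf E Q → ∀ {e} → e ∈ E → P e ≡ Q e
  subsetOf-injective E P Q eq {e} e∈ = begin
    P e                          ≡⟨ cong P (lookup-index e∈) ⟩
    P (lookup E i)               ≡⟨ sym (lookup∘tabulate (P ∘ lookup E) i) ⟩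
    Vec.lookup (subsetOf E P) i  ≡⟨ cong (λ S → Vec.lookup S i) eq ⟩
    Vec.lookup (subsetOf E Q) i  ≡⟨ lookup∘tabulate (Q ∘ lookup E) i ⟩
    Q (lookup E i)               ≡⟨ cong Q (sym (lookup-index e∈)) ⟩
    Q e                          ∎
    where
    open ≡-Reasoning
    i : Fin (length E)
    i = Any.index e∈

  -- Whether e occurs in E at a position in S (the first occurrence decides).
  member : (E : List X) → Subset (length E) → X → Bool
  member [] Vec.[] e = false
  member (x ∷ E) (b Vec.∷ S) e = if does (x ≟ˣ e) then b else member E S e

  member-lookup : ∀ E → Unique E → ∀ S i → member E S (lookup E i) ≡ Vec.lookup S i
  member-lookup (x ∷ E) _ (b Vec.∷ S) zero with x ≟ˣ x
  ... | yes _ = refl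
  ... | no x≢x = ⊥-elim (x≢x refl)
  member-lookup (x ∷ E) distinct@(_ ∷ distinct′) (b Vec.∷ S) (suc i) with x ≟ˣ lookup E i
  ... | yes refl = ⊥-elim (head∉tail distinct (∈-lookup i))
  ... | no _ = member-lookup E distinct′ S i

  subsetOf-member : ∀ E → Unique E → ∀ S → subsetOf E (member E S) ≡ S
  subsetOf-member E distinct S = trans (tabulate-cong (member-lookup E distinct S)) (tabulate∘lookup S)

module Encoding (n : ℕ) where
  open EdgeSubsets (≡-dec (_≟ⱽ_ {n}) (_≟ⱽ_ {n}))
  open ≡-Reasoning

  encode : Bits n → Subset (length (G n))
  encode β = subsetOf (G n) (selected n β)

  decode : Subset (length (G n)) → Bits n
  decode S = bitsOf n (member (G n) S)

  encode-injective : ∀ {β β′} → encode β ≡ encode β′ → β ≡ β′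
  encode-injective {β} {β′} eq = begin
    β                         ≡⟨ sym (bitsOf-selected n β) ⟩
    bitsOf n (selected n β)   ≡⟨ bitsOf-cong n (subsetOf-injective (G n) _ _ eq) ⟩
    bitsOf n (selected n β′)  ≡⟨ bitsOf-selected n β′ ⟩
    β′                        ∎

  encode-decode : ∀ S → encode (decode S) ≡ S
  encode-decode S = begin
    subsetOf (G n) (selected n (bitsOf n (member (G n) S)))
      ≡⟨ tabulate-cong (λ i → selected-bitsOf n (member (G n) S) (∈-lookup i)) ⟩
    subsetOf (G n) (member (G n) S)
      ≡⟨ subsetOf-member (G n) (G-unique n) S ⟩
    S ∎

  position⇒selected : ∀ β {i e} → i ∈ₛ encode β → lookup (G n) i ≡ e → selected n β e ≡ true
  position⇒selected β i∈ refl = subsetOf⁻ (G n) (selected n β) i∈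

  adj⇒chosen : ∀ β → Adj (G n) (encode β) ⇒ Chosen n β
  adj⇒chosen β (_ , i∈ , inj₁ eq) = inj₁ (position⇒selected β i∈ eq)
  adj⇒chosen β (_ , i∈ , inj₂ eq) = inj₂ (position⇒selected β i∈ eq)

  selected⇒position : ∀ β {e} → selected n β e ≡ true →
    Σ (Fin (length (G n))) λ i → i ∈ₛ encode β × lookup (G n) i ≡ e
  selected⇒position β {e} s =
    i , subsetOf⁺ (G n) (selected n β) (subst (λ e′ → selected n β e′ ≡ true) (lookup-index m) s) ,
    sym (lookup-index m)
    where
    m : e ∈ G n
    m = selected⇒∈G n β e s
    i : Fin (length (G n))
    i = Any.index m

  chosen⇒adj : ∀ β → Chosen n β ⇒ Adj (G n) (encode β)
  chosen⇒adj β (inj₁ s) with selected⇒position β s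
  ... | i , i∈ , eq = i , i∈ , inj₁ eq
  chosen⇒adj β (inj₂ s) with selected⇒position β s
  ... | i , i∈ , eq = i , i∈ , inj₂ eq

allBits : ∀ n → List (Bits n)
allBits zero = bools
allBits (suc n) = cartesianProduct allLocalBits (allBits n)

allBits-complete : ∀ n β → β ∈ allBits n
allBits-complete zero b = bools-complete b
allBits-complete (suc n) (lb , β) = ∈-cartesianProduct⁺ (allLocalBits-complete lb) (allBits-complete n β)

allBits-unique : ∀ n → Unique (allBits n)
allBits-unique zero = bools-unique
allBits-unique (suc n) = UniqueP.cartesianProduct⁺ allLocalBits-unique (allBits-unique n)
  where
  allLocalBits-unique : Unique allLocalBits
  allLocalBits-unique =
    UniqueP.cartesianProduct⁺ bools-unique (UniqueP.cartesianProduct⁺ bools-unique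
      (UniqueP.cartesianProduct⁺ bools-unique (UniqueP.cartesianProduct⁺ bools-unique bools-unique)))

hit : State → State → ℕ
hit s′ s = if does (s′ ≟ˢ s) then 1 else 0

count : {X : Set} → (X → State) → State → List X → ℕ
count c s [] = 0
count c s (x ∷ xs) = hit (c x) s + count c s xs

count-filter : ∀ {X : Set} (c : X → State) s xs → length (filter (λ x → c x ≟ˢ s) xs) ≡ count c s xs
count-filter c s [] = refl
count-filter c s (x ∷ xs) with does (c x ≟ˢ s)
... | true = cong suc (count-filter c s xs)
... | false = count-filter c s xs

count-++ : ∀ {X : Set} (c : X → State) s xs ys → count c s (xs ++ ys) ≡ count c s xs + count c s ys
count-++ c s [] ys = refl
count-++ c s (x ∷ xs) ys = trans (cong (hit (c x) s +_) (count-++ c s xs ys)) (sym (+-assoc (hit (c x) s) _ _))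

count-map : ∀ {X Y : Set} (c : Y → State) (f : X → Y) s xs → count c s (map f xs) ≡ count (c ∘ f) s xs
count-map c f s [] = refl
count-map c f s (x ∷ xs) = cong (hit (c (f x)) s +_) (count-map c f s xs)

Σ-states : (State → ℕ) → ℕ
Σ-states g = g tree + g twoTrees + g dead

Σ-distribˡ : ∀ (g h k : State → ℕ) →
  Σ-states (λ s → g s * h s) + Σ-states (λ s → g s * k s) ≡ Σ-states (λ s → g s * (h s + k s))
Σ-distribˡ g h k = algebra (g tree) (g twoTrees) (g dead) (h tree) (h twoTrees) (h dead)
                           (k tree) (k twoTrees) (k dead)
  where
  algebra : ∀ a b c x y z u v w → a * x + b * y + c * z + (a * u + b * v + c * w)
                                  ≡ a * (x + u) + b * (y + v) + c * (z + w)
  algebra = solve-∀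

Σ-distribʳ : ∀ (g h k : State → ℕ) →
  Σ-states (λ s → g s * k s) + Σ-states (λ s → h s * k s) ≡ Σ-states (λ s → (g s + h s) * k s)
Σ-distribʳ g h k = algebra (g tree) (g twoTrees) (g dead) (h tree) (h twoTrees) (h dead)
                           (k tree) (k twoTrees) (k dead)
  where
  algebra : ∀ a b c x y z u v w → a * u + b * v + c * w + (x * u + y * v + z * w)
                                  ≡ (a + x) * u + (b + y) * v + (c + z) * w
  algebra = solve-∀

count-fiber : ∀ {Y : Set} (f : State → State) (c : Y → State) s ys →
  count (f ∘ c) s ys ≡ Σ-states (λ s′ → hit (f s′) s * count c s′ ys)
count-fiber f c s [] = sym (algebra (g tree) (g twoTrees) (g dead))
  where
  g : State → ℕ
  g s′ = hit (f s′) s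
  algebra : ∀ a b d → a * 0 + b * 0 + d * 0 ≡ 0
  algebra = solve-∀
count-fiber f c s (y ∷ ys) = begin
  hit (f (c y)) s + count (f ∘ c) s ys
    ≡⟨ cong₂ _+_ (single (c y)) (count-fiber f c s ys) ⟩
  Σ-states (λ s′ → g s′ * hit (c y) s′) + Σ-states (λ s′ → g s′ * count c s′ ys)
    ≡⟨ Σ-distribˡ g (hit (c y)) (λ s′ → count c s′ ys) ⟩
  Σ-states (λ s′ → g s′ * count c s′ (y ∷ ys)) ∎
  where
  open ≡-Reasoning
  g : State → ℕ
  g s′ = hit (f s′) s
  single : ∀ t → g t ≡ Σ-states (λ s′ → g s′ * hit t s′)
  single tree = algebra (g tree) (g twoTrees) (g dead)
    where
    algebra : ∀ a b d → a ≡ a * 1 + b * 0 + d * 0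
    algebra = solve-∀
  single twoTrees = algebra (g tree) (g twoTrees) (g dead)
    where
    algebra : ∀ a b d → b ≡ a * 0 + b * 1 + d * 0
    algebra = solve-∀
  single dead = algebra (g tree) (g twoTrees) (g dead)
    where
    algebra : ∀ a b d → d ≡ a * 0 + b * 0 + d * 1
    algebra = solve-∀

count-product : ∀ {X Y : Set} (next : X → State → State) (c : Y → State) s xs ys →
  count (λ (x , y) → next x (c y)) s (cartesianProduct xs ys)
    ≡ Σ-states (λ s′ → count (λ x → next x s′) s xs * count c s′ ys)
count-product next c s [] ys = refl
count-product {X} {Y} next c s (x ∷ xs) ys = begin
  count F s (map (x ,_) ys ++ cartesianProduct xs ys)
    ≡⟨ count-++ F s (map (x ,_) ys) (cartesianProduct xs ys) ⟩
  count F s (map (x ,_) ys) + count F s (cartesianProduct xs ys)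
    ≡⟨ cong₂ _+_ (trans (count-map F (x ,_) s ys) (count-fiber (next x) c s ys)) (count-product next c s xs ys) ⟩
  Σ-states (λ s′ → hit (next x s′) s * N s′) + Σ-states (λ s′ → count (λ x → next x s′) s xs * N s′)
    ≡⟨ Σ-distribʳ (λ s′ → hit (next x s′) s) (λ s′ → count (λ x → next x s′) s xs) N ⟩
  Σ-states (λ s′ → count (λ x → next x s′) s (x ∷ xs) * N s′) ∎
  where
  open ≡-Reasoning
  F : X × Y → State
  F (x , y) = next x (c y)
  N : State → ℕ
  N s′ = count c s′ ys

trees forests deads : ℕ → ℕ
trees n = count (state n) tree (allBits n)
forests n = count (state n) twoTrees (allBits n)
deads n = count (state n) dead (allBits n)

transfer : State → State → ℕ
transfer s′ s = count (λ lb → step s′ lb) s allLocalBits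

count-step : ∀ n s → count (state (suc n)) s (allBits (suc n))
  ≡ Σ-states (λ s′ → transfer s′ s * count (state n) s′ (allBits n))
count-step n s = count-product (λ lb s′ → step s′ lb) (state n) s allLocalBits (allBits n)

-- The transfer numbers, obtained by evaluating `step` on the 32 local
-- patterns: tree → tree 8, twoTrees → tree 8, tree → twoTrees 4,
-- twoTrees → twoTrees 4, and dead leads to neither.
trees-step : ∀ n → trees (suc n) ≡ 8 * trees n + 8 * forests n + 0 * deads n
trees-step n = count-step n tree

forests-step : ∀ n → forests (suc n) ≡ 4 * trees n + 4 * forests n + 0 * deads n
forests-step n = count-step n twoTrees

-- Both live states have 12 successors in total, so t n + f n = 2 · 12ⁿ.
trees+forests : ∀ n → trees n + forests n ≡ 2 * 12 ^ n
trees+forests zero = refl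
trees+forests (suc n) = begin
  trees (suc n) + forests (suc n)
    ≡⟨ cong₂ _+_ (trees-step n) (forests-step n) ⟩
  (8 * trees n + 8 * forests n + 0 * deads n) + (4 * trees n + 4 * forests n + 0 * deads n)
    ≡⟨ algebra (trees n) (forests n) (deads n) ⟩
  12 * (trees n + forests n)
    ≡⟨ cong (12 *_) (trees+forests n) ⟩
  12 * (2 * 12 ^ n)
    ≡⟨ solve-∀′ (12 ^ n) ⟩
  2 * 12 ^ suc n ∎
  where
  open ≡-Reasoning
  algebra : ∀ t f d → (8 * t + 8 * f + 0 * d) + (4 * t + 4 * f + 0 * d) ≡ 12 * (t + f)
  algebra = solve-∀
  solve-∀′ : ∀ x → 12 * (2 * x) ≡ 2 * (12 * x)
  solve-∀′ = solve-∀

-- Every tree of G_(m+1) comes from a live G_m in 8 ways.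
trees-closed : ∀ m → trees (suc m) ≡ 16 * 12 ^ m
trees-closed m = begin
  trees (suc m)                               ≡⟨ trees-step m ⟩
  8 * trees m + 8 * forests m + 0 * deads m   ≡⟨ algebra (trees m) (forests m) (deads m) ⟩
  8 * (trees m + forests m)                   ≡⟨ cong (8 *_) (trees+forests m) ⟩
  8 * (2 * 12 ^ m)                            ≡⟨ algebra′ (12 ^ m) ⟩
  16 * 12 ^ m                                 ∎
  where
  open ≡-Reasoning
  algebra : ∀ t f d → 8 * t + 8 * f + 0 * d ≡ 8 * (t + f)
  algebra = solve-∀
  algebra′ : ∀ x → 8 * (2 * x) ≡ 16 * x
  algebra′ = solve-∀

power-form : ∀ m → 2 ^ (2 * suc m + 2) * 3 ^ m ≡ 16 * 12 ^ m
power-form zero = refl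
power-form (suc m) = begin
  2 ^ (2 * suc (suc m) + 2) * 3 ^ suc m   ≡⟨ cong (λ k → 2 ^ k * 3 ^ suc m) (exponent m) ⟩
  2 * (2 * 2 ^ (2 * suc m + 2)) * (3 * 3 ^ m)   ≡⟨ algebra (2 ^ (2 * suc m + 2)) (3 ^ m) ⟩
  12 * (2 ^ (2 * suc m + 2) * 3 ^ m)     ≡⟨ cong (12 *_) (power-form m) ⟩
  12 * (16 * 12 ^ m)                      ≡⟨ algebra′ (12 ^ m) ⟩
  16 * 12 ^ suc m                         ∎
  where
  open ≡-Reasoning
  exponent : ∀ m → 2 * suc (suc m) + 2 ≡ suc (suc (2 * suc m + 2))
  exponent = solve-∀
  algebra : ∀ x y → 2 * (2 * x) * (3 * y) ≡ 12 * (x * y)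
  algebra = solve-∀
  algebra′ : ∀ x → 12 * (16 * x) ≡ 16 * (12 * x)
  algebra′ = solve-∀

module _ {A : Set} {E : EdgeList A} {S : EdgeSubset E} where

  walk⇒star : ∀ {u v} → Walk E S u v → Star (Adj E S) u v
  walk⇒star Walk.here = ε
  walk⇒star (Walk.step a w) = a ◅ walk⇒star w

  star⇒walk : ∀ {u v} → Star (Adj E S) u v → Walk E S u v
  star⇒walk ε = Walk.here
  star⇒walk (a ◅ w) = Walk.step a (star⇒walk w)

  spanningTree⇒Tree : IsSpanningTree E S → Tree (Adj E S)
  spanningTree⇒Tree (connected , acyclic) = (λ u v → walk⇒star (connected u v)) , acyclic

  Tree⇒spanningTree : Tree (Adj E S) → IsSpanningTree E S
  Tree⇒spanningTree (connected , acyclic) = (λ u v → star⇒walk (connected u v)) , acyclic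

spanningTrees : ∀ n → NumSpanningTrees (G n) (trees n)
spanningTrees n = L , unique , (λ S → mk⇔ (listed⇒tree S) (tree⇒listed S)) , size
  where
  open Encoding n
  isTree? : ∀ β → Dec (state n β ≡ tree)
  isTree? β = state n β ≟ˢ tree
  L : List (Subset (length (G n)))
  L = map encode (filter isTree? (allBits n))
  unique : Unique L
  unique = UniqueP.map⁺ encode-injective (UniqueP.filter⁺ isTree? (allBits-unique n))
  tree-encoded : ∀ β → state n β ≡ tree → IsSpanningTree (G n) (encode β)
  tree-encoded β eq = Tree⇒spanningTree (Tree-resp (chosen⇒adj β) (adj⇒chosen β)
    (subst (λ s → Meaning s (Chosen n β) a₀ b₀) eq (state-correct n β)))
  encoded-tree : ∀ β → IsSpanningTree (G n) (encode β) → state n β ≡ tree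
  encoded-tree β t = tree-state (state n β) (state-correct n β)
    (Tree-resp (adj⇒chosen β) (chosen⇒adj β) (spanningTree⇒Tree t))
  listed⇒tree : ∀ S → S ∈ L → IsSpanningTree (G n) S
  listed⇒tree S m with ∈-map⁻ encode m
  ... | β , mβ , refl = tree-encoded β (proj₂ (∈-filter⁻ isTree? {xs = allBits n} mβ))
  tree⇒listed : ∀ S → IsSpanningTree (G n) S → S ∈ L
  tree⇒listed S t = subst (_∈ L) (encode-decode S)
    (∈-map⁺ encode (∈-filter⁺ isTree? (allBits-complete n β)
      (encoded-tree β (subst (IsSpanningTree (G n)) (sym (encode-decode S)) t))))
    where
    β : Bits n
    β = decode S
  size : length L ≡ trees n
  size = trans (length-map encode (filter isTree? (allBits n))) (count-filter (state n) tree (allBits n))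

theorem3p3 : (n : ℕ) → 1 ≤ n →
    NumSpanningTrees (G n) (2 ^ (2 * n + 2) * 3 ^ (n ∸ 1))
theorem3p3 (suc m) _ =
  subst (NumSpanningTrees (G (suc m))) (trans (trees-closed m) (sym (power-form m))) (spanningTrees (suc m))
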